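{- Let $M$ be an equivelar map with Schläfli type $\{p,q\}$, let $G$ be its type graph, and let $C$ be a connected component of $G_2$ (respectively of $G_0$). Then: if $C$ is a path, the number of vertices of $C$ divides $p$ (respectively $q$); if $C$ is a cycle, the number of vertices of $C$ divides $2p$ (respectively $2q$).
   Context: A map is a 2-cell embedding of a finite multigraph on a closed surface without boundary; its faces are the components of the complement of the graph. Its flags are the triangles of the induced triangulation with vertices a vertex of the map, the midpoint of an incident edge, and the centre of a face incident to that edge. Two flags are $0$-adjacent if they share the segment between edge-midpoint and face-centre, $1$-adjacent if they share the segment between vertex and face-centre, and $2$-adjacent if they share the segment between vertex and edge-midpoint. An automorphism of $M$ is a graph automorphism extending to a homeomorphism of the surface; $\Gamma(M)$ is the automorphism group. $M$ is equivelar with Schläfli type $\{p,q\}$ if every face has $p$ edges around it and every vertex has degree $q$. The type graph $G$ of $M$ is the labelled semi-graph whose vertices are the orbits of flags under $\Gamma(M)$, with an edge labelled $i$ between two distinct orbits whenever flags of one are $i$-adjacent to flags of the other, and a semi-edge labelled $i$ at an orbit $\mathcal{O}$ whenever a flag of $\mathcal{O}$ is $i$-adjacent to a flag of $\mathcal{O}$ ($i=0,1,2$). For $i\in\{0,1,2\}$, $G_i$ is obtained from $G$ by deleting all edges (and semi-edges) labelled $i$. -}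

module Defs where

open import Data.Nat using (ℕ; zero; suc; _<_; _+_; _*_)
open import Data.Fin using (Fin; toℕ) renaming (zero to 0F)
open import Data.Fin.Patterns using (1F; 2F)
open import Data.Fin.Permutation using (Permutation′; _⟨$⟩ʳ_)
open import Data.List using (List; length)
open import Data.List.Membership.Propositional using (_∈_)
open import Data.List.Relation.Unary.Unique.Propositional using (Unique)
open import Data.Product using (Σ; ∃; _×_)
open import Data.Bool using (if_then_else_)
open import Relation.Nullary using (¬_; does)
open import Relation.Binary.PropositionalEquality using (_≡_; _≢_)
open import Function.Bundles using (_⇔_)
import Data.Nat as N

-- Maps, combinatorially, as flag systems (flag graphs).
-- Flags are Fin n; r i is "the i-adjacent flag" (i = 0,1,2).

data Reach {n : ℕ} (r : Fin 3 → Fin n → Fin n) (f : Fin n) : Fin n → Set where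
  here : Reach r f f
  step : ∀ i {g} → Reach r f g → Reach r f (r i g)

record Map : Set where
  field
    n         : ℕ
    r         : Fin 3 → Fin n → Fin n
    invol     : ∀ i f → r i (r i f) ≡ f
    fpf       : ∀ i f → r i f ≢ f            -- surface without boundary
    comm02    : ∀ f → r 0F (r 2F f) ≡ r 2F (r 0F f)
    fpf02     : ∀ f → r 0F (r 2F f) ≢ f      -- each edge has 4 flags
    connected : ∀ f g → Reach r f g

open Map public

Flag : Map → Set
Flag M = Fin (n M)

iter : ∀ {A : Set} → ℕ → (A → A) → A → A
iter zero    h x = x
iter (suc m) h x = h (iter m h x)

OrbitSize : ∀ {A : Set} → (A → A) → A → ℕ → Set
OrbitSize h x m = (0 < m) × (iter m h x ≡ x) × (∀ j → 0 < j → j < m → iter j h x ≢ x)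

-- every face has p edges (r0 r1 rotates each face, orbit size p) and
-- every vertex has degree q (r1 r2 rotates around each vertex)
Equivelar : Map → ℕ → ℕ → Set
Equivelar M p q = ∀ f →
  OrbitSize (λ g → r M 0F (r M 1F g)) f p ×
  OrbitSize (λ g → r M 1F (r M 2F g)) f q

IsAut : (M : Map) → Permutation′ (n M) → Set
IsAut M α = ∀ i f → α ⟨$⟩ʳ (r M i f) ≡ r M i (α ⟨$⟩ʳ f)

-- f and g lie in the same orbit under Γ(M)  (= same vertex of type graph)
SameOrbit : (M : Map) → Flag M → Flag M → Set
SameOrbit M f g = Σ (Permutation′ (n M)) λ α → IsAut M α × (α ⟨$⟩ʳ f ≡ g)

TEdge : (M : Map) → Fin 3 → Flag M → Flag M → Set
TEdge M i a b = ¬ SameOrbit M a b ×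
  Σ (Flag M) λ a′ → Σ (Flag M) λ b′ →
    SameOrbit M a a′ × SameOrbit M b b′ × (r M i a′ ≡ b′)

data Side : Set where
  G₂ G₀ : Side

deleted : Side → Fin 3
deleted G₂ = 2F
deleted G₀ = 0F

param : Side → ℕ → ℕ → ℕ
param G₂ p q = p
param G₀ p q = q

DEdge : (M : Map) → Side → Fin 3 → Flag M → Flag M → Set
DEdge M s i a b = (i ≢ deleted s) × TEdge M i a b

data CompReach (M : Map) (s : Side) (a : Flag M) : Flag M → Set where
  start : ∀ {b} → SameOrbit M a b → CompReach M s a b
  move  : ∀ {b c} i → CompReach M s a b → DEdge M s i b c → CompReach M s a c

-- v : Fin k → Flag M lists one representative of each vertex (orbit) of the
-- component C of G_d containing the orbit of a, without repetition;
-- so C has exactly k vertices.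
record Enumerates (M : Map) (s : Side) (a : Flag M) (k : ℕ) (v : Fin k → Flag M) : Set where
  field
    inC      : ∀ j → CompReach M s a (v j)
    distinct : ∀ j l → SameOrbit M (v j) (v l) → j ≡ l
    covers   : ∀ b → CompReach M s a b → ∃ λ j → SameOrbit M b (v j)

EdgeCount : (M : Map) → Side → Flag M → Flag M → ℕ → Set
EdgeCount M s x y m = Σ (List (Fin 3)) λ ls →
  Unique ls × (length ls ≡ m) × (∀ i → (i ∈ ls) ⇔ DEdge M s i x y)

one? : ℕ → ℕ → ℕ
one? a b = if does (a N.≟ b) then 1 else 0

-- number of edges between positions j and l in the path v₀ — v₁ — … — v_{k-1}
pathMult : ∀ {k} → Fin k → Fin k → ℕ
pathMult j l = one? (toℕ l) (suc (toℕ j)) + one? (toℕ j) (suc (toℕ l))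

next : (k : ℕ) → Fin k → ℕ
next k j = if does (suc (toℕ j) N.≟ k) then 0 else suc (toℕ j)

-- number of edges between positions j and l in the cycle v₀ — … — v_{k-1} — v₀
cycleMult : ∀ {k} → Fin k → Fin k → ℕ
cycleMult {k} j l = one? (toℕ l) (next k j) + one? (toℕ j) (next k l)

IsPath : (M : Map) → Side → ∀ {k} → (Fin k → Flag M) → Set
IsPath M s v = ∀ j l → EdgeCount M s (v j) (v l) (pathMult j l)

IsCycle : (M : Map) → Side → ∀ {k} → (Fin k → Flag M) → Set
IsCycle M s v = ∀ j l → EdgeCount M s (v j) (v l) (cycleMult j l)

module Submission where

-- Let i, j be the two labels kept in G_s, ordered so that r_j ∘ r_i is the rotation of a face (G₂)
-- or around a vertex (G₀); it returns every flag to itself after p (resp. q) steps.  On the orbits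
-- v₀, …, v_{k-1} of C, r_i and r_j induce involutions whose non-trivial pairs are exactly the edges
-- of C, so the labels along C alternate.  Hence to every orbit together with the label applied next
-- one can attach a coordinate that each application of r_i or r_j raises by one: modulo 2k for a
-- path (a path with alternating labels and semi-edges at its ends is a 2k-cycle folded in half),
-- modulo k for a cycle.  Following a flag through p rotations, i.e. 2p steps, brings it back to its
-- orbit with the same next label, so 2k ∣ 2p, resp. k ∣ 2p.  Whether a step leaves the current orbit
-- is not decidable here, so the walk runs in the double-negation monad; divisibility is decidable,
-- which removes the double negation at the end.

open import Defs
open import Data.Nat using (ℕ; zero; suc; 2+; _+_; _*_; _∸_; _%_; _/_; _<_; s≤s; z≤n; s≤s⁻¹; NonZero)
open import Data.Nat.Properties
open import Data.Nat.DivMod using (m≡m%n+[m/n]*n; %-distribˡ-+; [m+n]%n≡m%n; n%n≡0)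
open import Data.Nat.Divisibility
  using (_∣_; _∣?_; 1∣_; m∣m*n; n∣m*n; *-cancelˡ-∣; divides; ∣m+n∣m⇒∣n)
open import Data.Fin using (Fin; toℕ; fromℕ; fromℕ<)
open import Data.Fin.Properties using (toℕ-injective; toℕ<n; toℕ-fromℕ; toℕ-fromℕ<)
open import Data.Fin.Patterns using (0F; 1F; 2F)
open import Data.Fin.Permutation
  using (_⟨$⟩ʳ_; _⟨$⟩ˡ_; inverseˡ; inverseʳ; flip; _∘ₚ_) renaming (id to idₚ)
open import Data.Bool using (Bool; true; false; not; _xor_; if_then_else_)
open import Data.Bool.Properties
  using (not-involutive; not-¬; ¬-not; xor-same; xor-inverseˡ; xor-inverseʳ) renaming (_≟_ to _≟ᵇ_)
open import Data.Product using (∃; ∃₂; _,_; _×_; proj₁; proj₂)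
open import Data.Sum using (_⊎_; inj₁; inj₂)
open import Data.List using ([]; _∷_)
open import Data.List.Relation.Unary.Any using (here)
open import Function using (_∘′_)
open import Function.Bundles using (Equivalence)
open import Effect.Monad using (RawMonad)
open import Level using (0ℓ)
open import Relation.Nullary using (¬_; yes; no; contradiction)
open import Relation.Nullary.Decidable
  using (dec-true; dec-false; ¬¬-excluded-middle; decidable-stable)
open import Relation.Nullary.Negation using (¬¬-Monad; ¬¬-map)
open import Relation.Binary.PropositionalEquality
import Data.Nat as ℕ

open RawMonad (¬¬-Monad {0ℓ}) using (_>>=_; return)

m∸n≡1+[m∸1+n] : ∀ m n → n < m → m ∸ n ≡ suc (m ∸ suc n)
m∸n≡1+[m∸1+n] (suc m) zero    _         = refl
m∸n≡1+[m∸1+n] (suc m) (suc n) (s≤s n<m) = m∸n≡1+[m∸1+n] m n n<m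

[m+n]%d≡m%d⇒d∣n : ∀ m n d .{{_ : NonZero d}} → (m + n) % d ≡ m % d → d ∣ n
[m+n]%d≡m%d⇒d∣n m n d eq = ∣m+n∣m⇒∣n (divides ((m + n) / d) q₂d+n≡q₁d) (n∣m*n (m / d))
  where
  open ≡-Reasoning
  q₂d+n≡q₁d : m / d * d + n ≡ (m + n) / d * d
  q₂d+n≡q₁d = +-cancelˡ-≡ (m % d) _ _ (begin
    m % d + (m / d * d + n)        ≡⟨ sym (+-assoc (m % d) _ n) ⟩
    m % d + m / d * d + n          ≡⟨ cong (_+ n) (sym (m≡m%n+[m/n]*n m d)) ⟩
    m + n                          ≡⟨ m≡m%n+[m/n]*n (m + n) d ⟩
    (m + n) % d + (m + n) / d * d  ≡⟨ cong (_+ (m + n) / d * d) eq ⟩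
    m % d + (m + n) / d * d        ∎)

%-cong-suc : ∀ {m n} d .{{_ : NonZero d}} → m % d ≡ n % d → suc m % d ≡ suc n % d
%-cong-suc {m} {n} d eq = begin
  suc m % d                ≡⟨ %-distribˡ-+ 1 m d ⟩
  (1 % d + m % d) % d      ≡⟨ cong (λ z → (1 % d + z) % d) eq ⟩
  (1 % d + n % d) % d      ≡⟨ %-distribˡ-+ 1 n d ⟨
  suc n % d                ∎
  where open ≡-Reasoning

-- Adj b x y: the label-b neighbour of position x is position y (x ≡ y being a semi-edge).
record Winding (k : ℕ) (Adj : Bool → ℕ → ℕ → Set) (N : ℕ) .{{_ : NonZero N}} : Set where
  field
    coord      : Bool → ℕ → ℕ
    coord-step : ∀ {b x y} → x < k → Adj b x y → coord (not b) y % N ≡ suc (coord b x) % N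

module AlternatingLabels (m : ℕ) (Adj : Bool → ℕ → ℕ → Set)
  (Adj-functional : ∀ {b x y z} → Adj b x y → Adj b x z → y ≡ z)
  (Adj-sym : ∀ {b x y} → Adj b x y → Adj b y x)
  (Adj-consecutive : ∀ x → suc x < suc (suc m) → ∃ λ b → Adj b x (suc x)) where

  k : ℕ
  k = suc (suc m)

  label : ℕ → Bool
  label zero    = proj₁ (Adj-consecutive 0 (s≤s (s≤s z≤n)))
  label (suc x) = not (label x)

  label-forward : ∀ x → suc x < k → Adj (label x) x (suc x)
  label-forward zero    _  = proj₂ (Adj-consecutive 0 (s≤s (s≤s z≤n)))
  label-forward (suc x) lt with Adj-consecutive (suc x) lt
  ... | b , adj with b ≟ᵇ label x
  ...   | yes refl = contradiction
                       (Adj-functional (Adj-sym (label-forward x (<-trans (n<1+n _) lt))) adj)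
                       (λ ())
  ...   | no b≢    = subst (λ c → Adj c (suc x) (suc (suc x))) (¬-not b≢) adj

  label-backward : ∀ x → suc x < k → Adj (not (label (suc x))) (suc x) x
  label-backward x lt = subst (λ c → Adj c (suc x) x) (sym (not-involutive (label x)))
                          (Adj-sym (label-forward x lt))

  -- Position x entered with next label b is x if b leads on to x + 1, and back x otherwise.
  coord : (ℕ → ℕ) → Bool → ℕ → ℕ
  coord back b x = if b xor label x then back x else x

  coord-forward : ∀ back x → coord back (label x) x ≡ x
  coord-forward back x rewrite xor-same (label x) = refl

  coord-backward : ∀ back x → coord back (not (label x)) x ≡ back x
  coord-backward back x rewrite xor-inverseˡ (label x) = refl

  module _ (N : ℕ) .{{_ : NonZero N}} (back : ℕ → ℕ)
    (back-step : ∀ x → suc x < k → back x % N ≡ suc (back (suc x)) % N)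
    (first-step : ∀ {y} → Adj (not (label 0)) 0 y →
                  coord back (label 0) y % N ≡ suc (back 0) % N)
    (last-step : ∀ {y} → Adj (label (suc m)) (suc m) y →
                 coord back (not (label (suc m))) y % N ≡ k % N)
    where

    advances-forward : ∀ {x y} → x < k → Adj (label x) x y →
                       coord back (not (label x)) y % N ≡ suc (coord back (label x) x) % N
    advances-forward {x} x<k adj rewrite coord-forward back x with suc x ℕ.<? k
    ... | yes sx<k rewrite Adj-functional adj (label-forward x sx<k) =
          cong (_% N) (coord-forward back (suc x))
    ... | no sx≮k with ≤-antisym (s≤s⁻¹ x<k) (s≤s⁻¹ (≮⇒≥ sx≮k))
    ...   | refl = last-step adj

    advances-backward : ∀ {x y} → x < k → Adj (not (label x)) x y →
                        coord back (not (not (label x))) y % N ≡ suc (coord back (not (label x)) x) % N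
    advances-backward {zero} _ adj
      rewrite not-involutive (label 0) | coord-backward back 0 = first-step adj
    advances-backward {suc x} x<k adj
      rewrite Adj-functional adj (label-backward x x<k) | not-involutive (label x)
            | coord-backward back x | xor-inverseʳ (label x) = back-step x x<k

    advances : ∀ {b x y} → x < k → Adj b x y → coord back (not b) y % N ≡ suc (coord back b x) % N
    advances {b} {x} x<k adj with b ≟ᵇ label x
    ... | yes refl = advances-forward x<k adj
    ... | no b≢ rewrite ¬-not b≢ = advances-backward x<k adj

    winding : Winding k Adj N
    winding = record { coord = coord back ; coord-step = advances }

  module Path
    (Adj-bounded : ∀ {b x y} → Adj b x y → y < k)
    (Adj-consecutive-only : ∀ {b x y} → Adj b x y → x ≢ y → y ≡ suc x ⊎ x ≡ suc y)
    (Adj-label-unique : ∀ {b b′ x} → Adj b x (suc x) → Adj b′ x (suc x) → b ≡ b′) where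

    first-semi-edge : ∀ {y} → Adj (not (label 0)) 0 y → y ≡ 0
    first-semi-edge {zero}  adj = refl
    first-semi-edge {suc y} adj with Adj-consecutive-only adj (λ ())
    ... | inj₁ refl = contradiction
                        (sym (Adj-label-unique adj (label-forward 0 (s≤s (s≤s z≤n)))))
                        (not-¬ refl)

    last-semi-edge : ∀ {y} → Adj (label (suc m)) (suc m) y → y ≡ suc m
    last-semi-edge {y} adj with y ≟ suc m
    ... | yes y≡ = y≡
    ... | no y≢ with Adj-consecutive-only adj (y≢ ∘′ sym)
    ...   | inj₁ refl = contradiction (Adj-bounded adj) (<-irrefl refl)
    ...   | inj₂ refl = contradiction (Adj-label-unique (label-forward m ≤-refl) (Adj-sym adj))
                                      (not-¬ refl)

    -- Position x traversed backwards is position 2k - 1 - x of the 2k-cycle folded onto the path.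
    pathBack : ℕ → ℕ
    pathBack x = k + (k ∸ suc x)

    path-winding : Winding k Adj (k + k)
    path-winding = winding (k + k) pathBack back-step first-step last-step
      where
      back-step : ∀ x → suc x < k → pathBack x % (k + k) ≡ suc (pathBack (suc x)) % (k + k)
      back-step x sx<k = cong (_% (k + k))
        (trans (cong (k +_) (m∸n≡1+[m∸1+n] k (suc x) sx<k)) (+-suc k _))

      first-step : ∀ {y} → Adj (not (label 0)) 0 y →
                   coord pathBack (label 0) y % (k + k) ≡ suc (pathBack 0) % (k + k)
      first-step adj rewrite first-semi-edge adj | coord-forward pathBack 0 =
        trans (sym (n%n≡0 (k + k))) (cong (_% (k + k)) (+-suc k (suc m)))

      last-step : ∀ {y} → Adj (label (suc m)) (suc m) y →
                  coord pathBack (not (label (suc m))) y % (k + k) ≡ k % (k + k)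
      last-step adj rewrite last-semi-edge adj | coord-backward pathBack (suc m) =
        cong (_% (k + k)) (trans (cong (k +_) (n∸n≡0 m)) (+-identityʳ k))

  module Cycle (m≢0 : m ≢ 0) (Adj-closing : ∃ λ b → Adj b (suc m) 0) where

    label-closing : Adj (label (suc m)) (suc m) 0
    label-closing = relabel (proj₂ Adj-closing)
      where
      relabel : ∀ {b} → Adj b (suc m) 0 → Adj (label (suc m)) (suc m) 0
      relabel {b} adj with b ≟ᵇ label (suc m)
      ... | yes refl = adj
      ... | no b≢    = contradiction
                         (Adj-functional (label-backward m ≤-refl)
                                         (subst (λ c → Adj c (suc m) 0) (¬-not b≢) adj))
                         m≢0

    label-0≡not-last : label 0 ≡ not (label (suc m))
    label-0≡not-last with label 0 ≟ᵇ label (suc m)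
    ... | no ≢  = ¬-not ≢
    ... | yes ≡ = contradiction
                    (Adj-functional (label-forward 0 (s≤s (s≤s z≤n)))
                                    (subst (λ c → Adj c 0 (suc m)) (sym ≡) (Adj-sym label-closing)))
                    (m≢0 ∘′ sym ∘′ suc-injective)

    cycleBack : ℕ → ℕ
    cycleBack x = k ∸ x

    cycle-winding : Winding k Adj k
    cycle-winding = winding k cycleBack back-step first-step last-step
      where
      back-step : ∀ x → suc x < k → cycleBack x % k ≡ suc (cycleBack (suc x)) % k
      back-step x sx<k = cong (_% k) (m∸n≡1+[m∸1+n] k x (<-trans (n<1+n x) sx<k))

      label-opening : Adj (not (label 0)) 0 (suc m)
      label-opening = subst (λ c → Adj c 0 (suc m))
                        (sym (trans (cong not label-0≡not-last) (not-involutive _)))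
                        (Adj-sym label-closing)

      first-step : ∀ {y} → Adj (not (label 0)) 0 y →
                   coord cycleBack (label 0) y % k ≡ suc (cycleBack 0) % k
      first-step adj rewrite Adj-functional adj label-opening | label-0≡not-last
                           | coord-backward cycleBack (suc m) =
        trans (cong (_% k) (m+n∸n≡m 1 m)) (sym ([m+n]%n≡m%n 1 k))

      last-step : ∀ {y} → Adj (label (suc m)) (suc m) y →
                  coord cycleBack (not (label (suc m))) y % k ≡ k % k
      last-step adj rewrite Adj-functional adj label-closing | sym label-0≡not-last
                          | coord-forward cycleBack 0 =
        sym (n%n≡0 k)

module _ (M : Map) where

  sameOrbit-refl : ∀ {f} → SameOrbit M f f
  sameOrbit-refl = idₚ , (λ _ _ → refl) , refl

  sameOrbit-sym : ∀ {f g} → SameOrbit M f g → SameOrbit M g f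
  sameOrbit-sym (α , α-aut , refl) = flip α , flip-aut , inverseˡ α
    where
    open ≡-Reasoning
    flip-aut : IsAut M (flip α)
    flip-aut i f = begin
      α ⟨$⟩ˡ r M i f                      ≡⟨ cong (λ g → α ⟨$⟩ˡ r M i g) (inverseʳ α) ⟨
      α ⟨$⟩ˡ r M i (α ⟨$⟩ʳ (α ⟨$⟩ˡ f))    ≡⟨ cong (α ⟨$⟩ˡ_) (α-aut i _) ⟨
      α ⟨$⟩ˡ (α ⟨$⟩ʳ r M i (α ⟨$⟩ˡ f))    ≡⟨ inverseˡ α ⟩
      r M i (α ⟨$⟩ˡ f)                    ∎

  sameOrbit-trans : ∀ {f g h} → SameOrbit M f g → SameOrbit M g h → SameOrbit M f h
  sameOrbit-trans (α , α-aut , refl) (β , β-aut , refl) =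
    α ∘ₚ β , (λ i f → trans (cong (β ⟨$⟩ʳ_) (α-aut i f)) (β-aut i _)) , refl

  sameOrbit-r : ∀ i {f g} → SameOrbit M f g → SameOrbit M (r M i f) (r M i g)
  sameOrbit-r i (α , α-aut , refl) = α , α-aut , α-aut i _

kept : Side → Bool → Fin 3
kept G₂ true  = 1F
kept G₂ false = 0F
kept G₀ true  = 2F
kept G₀ false = 1F

kept-≢-deleted : ∀ s b → kept s b ≢ deleted s
kept-≢-deleted G₂ true  ()
kept-≢-deleted G₂ false ()
kept-≢-deleted G₀ true  ()
kept-≢-deleted G₀ false ()

kept-surjective : ∀ s i → i ≢ deleted s → ∃ λ b → kept s b ≡ i
kept-surjective G₂ 0F _  = false , refl
kept-surjective G₂ 1F _  = true , refl
kept-surjective G₂ 2F ne = contradiction refl ne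
kept-surjective G₀ 0F ne = contradiction refl ne
kept-surjective G₀ 1F _  = false , refl
kept-surjective G₀ 2F _  = true , refl

kept-injective : ∀ s {b b′} → kept s b ≡ kept s b′ → b ≡ b′
kept-injective G₂ {true}  {true}  _ = refl
kept-injective G₂ {false} {false} _ = refl
kept-injective G₀ {true}  {true}  _ = refl
kept-injective G₀ {false} {false} _ = refl

rotation : (M : Map) → Side → Flag M → Flag M
rotation M s f = r M (kept s false) (r M (kept s true) f)

rotation-order : ∀ M p q → Equivelar M p q → ∀ s f → iter (param s p q) (rotation M s) f ≡ f
rotation-order M p q eqv G₂ f = proj₁ (proj₂ (proj₁ (eqv f)))
rotation-order M p q eqv G₀ f = proj₁ (proj₂ (proj₂ (eqv f)))

module EdgeCountProperties (M : Map) (s : Side) {x y : Flag M} where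

  EdgeCount-≢0⇒DEdge : ∀ {m} → EdgeCount M s x y m → m ≢ 0 → ∃ λ i → DEdge M s i x y
  EdgeCount-≢0⇒DEdge ([]    , _ , refl , _)   nz = contradiction refl nz
  EdgeCount-≢0⇒DEdge (i ∷ _ , _ , _    , i∈⇔) _  = i , Equivalence.to (i∈⇔ i) (here refl)

  DEdge⇒EdgeCount-≢0 : ∀ {m i} → EdgeCount M s x y m → DEdge M s i x y → m ≢ 0
  DEdge⇒EdgeCount-≢0 ([] , _ , _ , i∈⇔) e _ with Equivalence.from (i∈⇔ _) e
  ... | ()
  DEdge⇒EdgeCount-≢0 (_ ∷ _ , _ , refl , _) _ ()

  EdgeCount-1⇒DEdge-unique : ∀ {i i′} → EdgeCount M s x y 1 →
                             DEdge M s i x y → DEdge M s i′ x y → i ≡ i′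
  EdgeCount-1⇒DEdge-unique (_ ∷ [] , _ , refl , i∈⇔) e e′
    with Equivalence.from (i∈⇔ _) e | Equivalence.from (i∈⇔ _) e′
  ... | here refl | here refl = refl

CompReach-respects-orbit : ∀ {M s a f g} →
                           CompReach M s a f → SameOrbit M f g → CompReach M s a g
CompReach-respects-orbit {M} (start a~f) f~g = start (sameOrbit-trans M a~f f~g)
CompReach-respects-orbit {M} (move i reach (i≢d , b≁f , b′ , f′ , b~b′ , f~f′ , rb′≡f′)) f~g =
  move i reach (i≢d , (λ b~g → b≁f (sameOrbit-trans M b~g (sameOrbit-sym M f~g))) ,
                b′ , f′ , b~b′ , sameOrbit-trans M (sameOrbit-sym M f~g) f~f′ , rb′≡f′)

module Component (M : Map) (s : Side) (a : Flag M) (k : ℕ) (v : Fin k → Flag M)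
                 (en : Enumerates M s a k v) where
  open Enumerates en
  open EdgeCountProperties M s

  ClassAdj : Bool → Fin k → Fin k → Set
  ClassAdj b j j′ = ∃ λ g → SameOrbit M (v j) g × SameOrbit M (v j′) (r M (kept s b) g)

  ClassAdj-functional : ∀ {b j j′ j″} → ClassAdj b j j′ → ClassAdj b j j″ → j′ ≡ j″
  ClassAdj-functional (g , j~g , j′~rg) (h , j~h , j″~rh) =
    distinct _ _ (sameOrbit-trans M j′~rg
      (sameOrbit-trans M (sameOrbit-r M _ (sameOrbit-trans M (sameOrbit-sym M j~g) j~h))
                         (sameOrbit-sym M j″~rh)))

  ClassAdj-sym : ∀ {b j j′} → ClassAdj b j j′ → ClassAdj b j′ j
  ClassAdj-sym {b} (g , j~g , j′~rg) =
    r M (kept s b) g , j′~rg , subst (SameOrbit M _) (sym (invol M _ g)) j~g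

  ClassAdj⇒DEdge : ∀ {b j j′} → ClassAdj b j j′ → j ≢ j′ → DEdge M s (kept s b) (v j) (v j′)
  ClassAdj⇒DEdge {b} (g , j~g , j′~rg) j≢j′ =
    kept-≢-deleted s b , (λ j~j′ → j≢j′ (distinct _ _ j~j′)) , g , _ , j~g , j′~rg , refl

  DEdge⇒ClassAdj : ∀ {i j j′} → DEdge M s i (v j) (v j′) → ∃ λ b → ClassAdj b j j′
  DEdge⇒ClassAdj {i} (i≢d , _ , g , _ , j~g , j′~h , refl) with kept-surjective s i i≢d
  ... | b , refl = b , g , j~g , j′~h

  ClassAdj⇒EdgeCount-≢0 : ∀ {m b j j′} → EdgeCount M s (v j) (v j′) m → ClassAdj b j j′ →
                          j ≢ j′ → m ≢ 0
  ClassAdj⇒EdgeCount-≢0 ec adj j≢j′ = DEdge⇒EdgeCount-≢0 ec (ClassAdj⇒DEdge adj j≢j′)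

  Adj : Bool → ℕ → ℕ → Set
  Adj b x y = ∃₂ λ j j′ → toℕ j ≡ x × toℕ j′ ≡ y × ClassAdj b j j′

  Adj-functional : ∀ {b x y z} → Adj b x y → Adj b x z → y ≡ z
  Adj-functional (j , j′ , refl , refl , adj) (i , i′ , i≡j , refl , adj′)
    with toℕ-injective i≡j
  ... | refl = cong toℕ (ClassAdj-functional adj adj′)

  Adj-sym : ∀ {b x y} → Adj b x y → Adj b y x
  Adj-sym (j , j′ , refl , refl , adj) = j′ , j , refl , refl , ClassAdj-sym adj

  Adj-bounded : ∀ {b x y} → Adj b x y → y < k
  Adj-bounded (_ , j′ , _ , refl , _) = toℕ<n j′

  EdgeCount-≢0⇒Adj : ∀ {m x y} (j j′ : Fin k) → toℕ j ≡ x → toℕ j′ ≡ y →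
                     EdgeCount M s (v j) (v j′) m → m ≢ 0 → ∃ λ b → Adj b x y
  EdgeCount-≢0⇒Adj j j′ j≡x j′≡y ec nz with DEdge⇒ClassAdj (proj₂ (EdgeCount-≢0⇒DEdge ec nz))
  ... | b , adj = b , j , j′ , j≡x , j′≡y , adj

  Adj-consecutive-of : ∀ {mult : Fin k → Fin k → ℕ} →
                       (∀ j j′ → EdgeCount M s (v j) (v j′) (mult j j′)) →
                       (∀ j j′ → toℕ j′ ≡ suc (toℕ j) → mult j j′ ≢ 0) →
                       ∀ x → suc x < k → ∃ λ b → Adj b x (suc x)
  Adj-consecutive-of edges consecutive-≢0 x sx<k =
    EdgeCount-≢0⇒Adj j j′ (toℕ-fromℕ< x<k) (toℕ-fromℕ< sx<k) (edges j j′)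
      (consecutive-≢0 j j′ (trans (toℕ-fromℕ< sx<k) (cong suc (sym (toℕ-fromℕ< x<k)))))
    where
    x<k = <-trans (n<1+n x) sx<k
    j   = fromℕ< x<k
    j′  = fromℕ< sx<k

  class-step : ∀ b {j g} → SameOrbit M (v j) g →
               ¬ ¬ (∃ λ j′ → SameOrbit M (v j′) (r M (kept s b) g) × ClassAdj b j j′)
  class-step b {j} {g} j~g = do
    no g≁rg ← ¬¬-excluded-middle
      where yes g~rg → let j~rg = sameOrbit-trans M j~g g~rg in return (j , j~rg , g , j~g , j~rg)
    let reach = move (kept s b) (CompReach-respects-orbit (inC j) j~g)
                  (kept-≢-deleted s b , g≁rg , g , _ , sameOrbit-refl M , sameOrbit-refl M , refl)
        (j′ , rg~j′) = covers _ reach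
    return (j′ , sameOrbit-sym M rg~j′ , g , j~g , sameOrbit-sym M rg~j′)

  j₀ : Fin k
  j₀ = proj₁ (covers a (start (sameOrbit-refl M)))

  j₀~a : SameOrbit M (v j₀) a
  j₀~a = sameOrbit-sym M (proj₂ (covers a (start (sameOrbit-refl M))))

  module _ {N : ℕ} .{{_ : NonZero N}} (w : Winding k Adj N) where
    open Winding w

    c₀ : ℕ
    c₀ = coord true (toℕ j₀)

    Position : ℕ → Set
    Position n = ∃ λ j → SameOrbit M (v j) (iter n (rotation M s) a) ×
                         coord true (toℕ j) % N ≡ (c₀ + 2 * n) % N

    position : ∀ n → ¬ ¬ Position n
    position zero = return (j₀ , j₀~a , cong (_% N) (sym (+-identityʳ c₀)))
    position (suc n) = do
      (j , j~f , cj)        ← position n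
      (j′ , j′~rf , adj)    ← class-step true j~f
      (j″ , j″~rrf , adj′)  ← class-step false j′~rf
      return (j″ , j″~rrf , two-steps (coord-step (toℕ<n j) (j , j′ , refl , refl , adj))
                                      (coord-step (toℕ<n j′) (j′ , j″ , refl , refl , adj′)) cj)
      where
      open ≡-Reasoning
      two-steps : ∀ {x y z} → y % N ≡ suc x % N → z % N ≡ suc y % N →
                  x % N ≡ (c₀ + 2 * n) % N → z % N ≡ (c₀ + 2 * suc n) % N
      two-steps {x} {y} {z} y≡ z≡ x≡ = begin
        z % N                      ≡⟨ z≡ ⟩
        suc y % N                  ≡⟨ %-cong-suc N y≡ ⟩
        suc (suc x) % N            ≡⟨ %-cong-suc N (%-cong-suc N x≡) ⟩
        suc (suc (c₀ + 2 * n)) % N ≡⟨ cong (λ t → suc t % N) (+-suc c₀ _) ⟨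
        suc (c₀ + suc (2 * n)) % N ≡⟨ cong (_% N) (+-suc c₀ _) ⟨
        (c₀ + (2 + 2 * n)) % N     ≡⟨ cong (λ t → (c₀ + t) % N) (*-suc 2 n) ⟨
        (c₀ + 2 * suc n) % N       ∎

    winding-∣-period : ∀ P → iter P (rotation M s) a ≡ a → ¬ ¬ (N ∣ 2 * P)
    winding-∣-period P loop = do
      (j , j~a , cj) ← position P
      let j≡j₀ = distinct j j₀ (sameOrbit-trans M (subst (SameOrbit M (v j)) loop j~a)
                                                  (sameOrbit-sym M j₀~a))
          c₀≡  = subst (λ i → coord true (toℕ i) % N ≡ (c₀ + 2 * P) % N) j≡j₀ cj
      return ([m+n]%d≡m%d⇒d∣n c₀ (2 * P) N (sym c₀≡))

one?-≡ : ∀ {m n} → m ≡ n → one? m n ≡ 1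
one?-≡ {m} {n} eq rewrite dec-true (m ℕ.≟ n) eq = refl

one?-≢ : ∀ {m n} → m ≢ n → one? m n ≡ 0
one?-≢ {m} {n} ne rewrite dec-false (m ℕ.≟ n) ne = refl

one?-+-≢0 : ∀ {m n} o → m ≡ n → one? m n + o ≢ 0
one?-+-≢0 o eq rewrite one?-≡ eq = λ ()

one?+one?≢0 : ∀ {m n o p} → one? m n + one? o p ≢ 0 → m ≡ n ⊎ o ≡ p
one?+one?≢0 {m} {n} {o} {p} nz with m ℕ.≟ n | o ℕ.≟ p
... | yes eq | _      = inj₁ eq
... | no _   | yes eq = inj₂ eq
... | no ne  | no ne′ = contradiction (cong₂ _+_ (one?-≢ ne) (one?-≢ ne′)) nz

next-≢ : ∀ {k} (j : Fin k) → suc (toℕ j) ≢ k → next k j ≡ suc (toℕ j)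
next-≢ {k} j ne rewrite dec-false (suc (toℕ j) ℕ.≟ k) ne = refl

next-≡ : ∀ {k} (j : Fin k) → suc (toℕ j) ≡ k → next k j ≡ 0
next-≡ {k} j eq rewrite dec-true (suc (toℕ j) ℕ.≟ k) eq = refl

module PathComponent (M : Map) (s : Side) (a : Flag M) (m : ℕ) (v : Fin (2 + m) → Flag M)
                     (en : Enumerates M s a (2 + m) v) (path : IsPath M s v) where
  open Component M s a (2 + m) v en
  open EdgeCountProperties M s

  Adj-consecutive : ∀ x → suc x < 2 + m → ∃ λ b → Adj b x (suc x)
  Adj-consecutive = Adj-consecutive-of path (λ _ _ → one?-+-≢0 _)

  Adj-consecutive-only : ∀ {b x y} → Adj b x y → x ≢ y → y ≡ suc x ⊎ x ≡ suc y
  Adj-consecutive-only (j , j′ , refl , refl , adj) x≢y =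
    one?+one?≢0 (ClassAdj⇒EdgeCount-≢0 (path j j′) adj (x≢y ∘′ cong toℕ))

  Adj-label-unique : ∀ {b b′ x} → Adj b x (suc x) → Adj b′ x (suc x) → b ≡ b′
  Adj-label-unique (j , j′ , refl , j′≡ , adj) (i , i′ , i≡ , i′≡ , adj′)
    with toℕ-injective i≡ | toℕ-injective (trans i′≡ (sym j′≡))
  ... | refl | refl = kept-injective s (EdgeCount-1⇒DEdge-unique single-edge
                        (ClassAdj⇒DEdge adj j≢j′) (ClassAdj⇒DEdge adj′ j≢j′))
    where
    j≢j′ : j ≢ j′
    j≢j′ j≡j′ = 1+n≢n (sym (trans (cong toℕ j≡j′) j′≡))
    n≢2+n : ∀ {n} → n ≢ 2 + n
    n≢2+n ()
    single-edge : EdgeCount M s (v j) (v j′) 1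
    single-edge = subst (EdgeCount M s (v j) (v j′))
      (cong₂ _+_ (one?-≡ j′≡) (one?-≢ (λ eq → n≢2+n (trans eq (cong suc j′≡))))) (path j j′)

  open AlternatingLabels.Path m Adj Adj-functional Adj-sym Adj-consecutive
         Adj-bounded Adj-consecutive-only Adj-label-unique using (path-winding)

  path-∣-period : ∀ P → iter P (rotation M s) a ≡ a → 2 + m ∣ P
  path-∣-period P loop =
    decidable-stable (2 + m ∣? P) (¬¬-map halve (winding-∣-period path-winding P loop))
    where
    halve : (2 + m) + (2 + m) ∣ 2 * P → 2 + m ∣ P
    halve = *-cancelˡ-∣ 2 ∘′ subst (_∣ 2 * P) (cong (2 + m +_) (sym (+-identityʳ (2 + m))))

module CycleComponent (M : Map) (s : Side) (a : Flag M) (m : ℕ) (v : Fin (3 + m) → Flag M)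
                      (en : Enumerates M s a (3 + m) v) (cycle : IsCycle M s v) where
  open Component M s a (3 + m) v en

  Adj-consecutive : ∀ x → suc x < 3 + m → ∃ λ b → Adj b x (suc x)
  Adj-consecutive = Adj-consecutive-of cycle λ j j′ j′≡ →
    one?-+-≢0 _ (trans j′≡ (sym (next-≢ j (λ j+1≡k → <-irrefl (trans j′≡ j+1≡k) (toℕ<n j′)))))

  Adj-closing : ∃ λ b → Adj b (2 + m) 0
  Adj-closing = EdgeCount-≢0⇒Adj (fromℕ (2 + m)) 0F (toℕ-fromℕ _) refl (cycle _ _)
    (one?-+-≢0 _ (sym (next-≡ (fromℕ (2 + m)) (cong suc (toℕ-fromℕ _)))))

  open AlternatingLabels.Cycle (suc m) Adj Adj-functional Adj-sym Adj-consecutive (λ ()) Adj-closing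
    using (cycle-winding)

  cycle-∣-period : ∀ P → iter P (rotation M s) a ≡ a → 3 + m ∣ 2 * P
  cycle-∣-period P loop = decidable-stable (3 + m ∣? 2 * P) (winding-∣-period cycle-winding P loop)

mainTheorem2 : (M : Map) (p q : ℕ) → Equivelar M p q → (s : Side) (a : Flag M)
    (k : ℕ) (v : Fin k → Flag M) → Enumerates M s a k v →
    (IsPath M s v → k ∣ param s p q) × (IsCycle M s v → k ∣ 2 * param s p q)
mainTheorem2 M p q eqv s a zero v en with Enumerates.covers en a (start (sameOrbit-refl M))
... | () , _
mainTheorem2 M p q eqv s a 1 v en = (λ _ → 1∣ _) , (λ _ → 1∣ _)
mainTheorem2 M p q eqv s a (2+ m) v en = on-path , on-cycle m v en
  where
  loop : iter (param s p q) (rotation M s) a ≡ a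
  loop = rotation-order M p q eqv s a

  on-path : IsPath M s v → 2 + m ∣ param s p q
  on-path path = PathComponent.path-∣-period M s a m v en path (param s p q) loop

  on-cycle : ∀ m (v : Fin (2 + m) → Flag M) → Enumerates M s a (2 + m) v →
             IsCycle M s v → 2 + m ∣ 2 * param s p q
  on-cycle zero    _ _  _     = m∣m*n (param s p q)
  on-cycle (suc m) v en cycle = CycleComponent.cycle-∣-period M s a m v en cycle (param s p q) loop
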